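{- Let $d \ge 2$ be an integer and let $A_d$ be the adjacency matrix of $\Gamma_d$. Then $$\left(A_d^{ -1}\right)^{T}\left(\frac{1}{2}A_d - \binom{d}{2} J_{3d-1}\right) A_d^{ -1} = \frac{W_{3d-1} - J_{3d-1}}{2}.$$
   Context: For an integer $d \ge 1$, $\Gamma_d$ is the graph on vertex set $[3d-1]$ whose edges are all pairs $\{i, i+3t+1\}$ for $i \in [3d-1]$ and $0 \le t \le \lceil d/2\rceil - 1$, with labels taken modulo $3d-1$ (so the edges are $\{i,i+1\},\{i,i+4\},\ldots,\{i,i+3\lceil d/2\rceil-2\}$); it is $d$-regular and its adjacency matrix is invertible. For an integer $m \ge 3$, $J_m$ is the $m \times m$ all-ones matrix and $W_m$ is the $m\times m$ circulant $0/1$ matrix with $W_m(i,j) = 1$ iff $j - i \equiv -1, 0, 1 \pmod m$. -}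

module Defs where

open import Data.Nat as ℕ using (ℕ; zero; suc; _∸_; _≤ᵇ_; _≡ᵇ_; ⌈_/2⌉)
open import Data.Nat.Combinatorics using (_C_)
open import Data.Bool using (Bool; true; false; if_then_else_; _∨_)
open import Data.Fin using (Fin; toℕ)
import Data.Fin as F
open import Data.Integer using (+_)
open import Data.Rational using (ℚ; 0ℚ; 1ℚ; ½; _+_; _*_; _-_; _/_)
open import Data.List using (List; upTo)
open import Data.Bool.ListAction using (any)
open import Relation.Binary.PropositionalEquality using (_≡_)

Mat : ℕ → Set
Mat n = Fin n → Fin n → ℚ

ℕ→ℚ : ℕ → ℚ
ℕ→ℚ k = + k / 1

∑ : (n : ℕ) → (Fin n → ℚ) → ℚ
∑ zero f = 0ℚ
∑ (suc n) f = f F.zero + ∑ n (λ i → f (F.suc i))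

_·_ : {n : ℕ} → Mat n → Mat n → Mat n
_·_ {n} M N i j = ∑ n (λ k → M i k * N k j)

_ᵀ : {n : ℕ} → Mat n → Mat n
(M ᵀ) i j = M j i

_⊕_ : {n : ℕ} → Mat n → Mat n → Mat n
(M ⊕ N) i j = M i j + N i j

_⊖_ : {n : ℕ} → Mat n → Mat n → Mat n
(M ⊖ N) i j = M i j - N i j

_•_ : {n : ℕ} → ℚ → Mat n → Mat n
(c • M) i j = c * M i j

Id : (n : ℕ) → Mat n
Id n i j = if toℕ i ≡ᵇ toℕ j then 1ℚ else 0ℚ

J : (n : ℕ) → Mat n
J n i j = 1ℚ

-- (j - i) mod n, as a natural number in [0, n), for i j : Fin n
diffmod : (n : ℕ) → Fin n → Fin n → ℕ
diffmod n i j =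
  if toℕ i ≤ᵇ toℕ j then toℕ j ∸ toℕ i else (n ∸ toℕ i) ℕ.+ toℕ j

-- "j - i ≡ s (mod n)" for 0 ≤ s < n
-- and "j - i ≡ -s (mod n)" for 0 < s < n
plusStep : (n s : ℕ) → Fin n → Fin n → Bool
plusStep n s i j = diffmod n i j ≡ᵇ s

minusStep : (n s : ℕ) → Fin n → Fin n → Bool
minusStep n s i j = diffmod n i j ℕ.+ s ≡ᵇ n

W : (n : ℕ) → Mat n
W n i j =
  if plusStep n 0 i j ∨ plusStep n 1 i j ∨ minusStep n 1 i j
  then 1ℚ else 0ℚ

-- vertex count of Γ_d  (vertex set [3d-1] encoded as Fin (3d-1), label k ↦ k-1)
N : ℕ → ℕ
N d = 3 ℕ.* d ∸ 1

A : (d : ℕ) → Mat (N d)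
A d i j =
  if any (λ t → plusStep (N d) (3 ℕ.* t ℕ.+ 1) i j
                ∨ minusStep (N d) (3 ℕ.* t ℕ.+ 1) i j)
         (upTo ⌈ d /2⌉)
  then 1ℚ else 0ℚ

_≡ᴹ_ : {n : ℕ} → Mat n → Mat n → Set
_≡ᴹ_ {n} M M' = (i j : Fin n) → M i j ≡ M' i j

-- Write n = 3d − 1 = 3m + 2 and D = (j − i) mod n.  Since n ≡ 2 (mod 3), the
-- backward step −(3t+1) is the forward step 3(m−t)+1, so the steps of Γ_d are
-- exactly the D ≡ 1 (mod 3): A is the circulant matrix with that symbol, and W
-- the circulant of {0, ±1}.  Thus (AW)ᵢⱼ counts the residues ≡ 1 (mod 3) among
-- D, D+1, D−1: one of three consecutive numbers, except at D = 0 where both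
-- neighbours 1 and n−1 = 3m+1 qualify.  Hence AW = I + J.  As W has row sums 3
-- and n + 1 = 3d, this forces AJ = dJ, so B = W − J/d is a right inverse of A,
-- and a left one by symmetry.  The columns of B sum to 3 − n/d = 1/d, whence
-- Bᵀ(½A − C(d,2)J)B = ½B − C(d,2)/d² J = ½(W − J).

{-# OPTIONS --safe #-}
module Submission where

open import Defs
open import Data.Nat using (ℕ; _≥_)
open import Data.Nat.Combinatorics using (_C_)
open import Data.Product using (Σ; _×_)
open import Data.Product using (_,_)
open import Data.Rational using (½)
open import Data.Nat using (zero; suc; _≤_; _≡ᵇ_; s≤s)
open import Data.Nat.Properties using (≡ᵇ⇒≡; ≡⇒≡ᵇ)
open import Data.Bool using (Bool; T; if_then_else_)
open import Data.Bool.Properties using (T-≡; ⇔→≡)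
open import Data.Rational using (ℚ; 0ℚ; 1ℚ)
open import Function using (_⇔_; mk⇔)
import Function.Properties.Equivalence as ⇔
open import Relation.Binary.PropositionalEquality using (_≡_)

T-⇔⇒≡ : ∀ {x y} → T x ⇔ T y → x ≡ y
T-⇔⇒≡ x⇔y = ⇔→≡ (⇔.trans (⇔.sym T-≡) (⇔.trans x⇔y T-≡))

T-≡ᵇ⇔≡ : ∀ {m n} → T (m ≡ᵇ n) ⇔ m ≡ n
T-≡ᵇ⇔≡ {m} {n} = mk⇔ (≡ᵇ⇒≡ m n) (≡⇒≡ᵇ m n)

≡ᵇ-cong-⇔ : ∀ {a b c d} → (a ≡ b ⇔ c ≡ d) → (a ≡ᵇ b) ≡ (c ≡ᵇ d)
≡ᵇ-cong-⇔ h = T-⇔⇒≡ (⇔.trans T-≡ᵇ⇔≡ (⇔.trans h (⇔.sym T-≡ᵇ⇔≡)))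

𝟙 : Bool → ℚ
𝟙 b = if b then 1ℚ else 0ℚ

module Matrices where

  open import Data.Nat as ℕ using ()
  import Data.Nat.Coprimality as ℕ-coprime
  open import Data.Nat.Combinatorics using (nC1≡n; nCk+nC[k+1]≡[n+1]C[k+1])
  import Data.Nat.Tactic.RingSolver as ℕ-solve
  open import Data.Integer as ℤ using ()
  import Data.Integer.Properties as ℤ
  open import Data.Product using (∃-syntax; proj₁; proj₂)
  open import Data.Fin as Fin using (Fin; toℕ)
  open import Function using (_∘_)
  open import Data.Rational using (mkℚ; _+_; _*_; _-_; _/_; 1/_)
  open import Data.Rational.Properties
    using (*-comm; *-assoc; *-zeroʳ; *-identityˡ; *-identityʳ; normalize-coprime; *-inverseˡ)
  open import Data.Rational.Solver using (module +-*-Solver)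
  open import Level using (0ℓ)
  open import Relation.Binary.Bundles using (Setoid)
  import Relation.Binary.Reasoning.Setoid as SetoidReasoning
  open import Relation.Binary.PropositionalEquality hiding (J)

  open +-*-Solver

  ℕ→ℚ≡mkℚ : ∀ k → ℕ→ℚ k ≡ mkℚ (ℤ.+ k) 0 (ℕ-coprime.sym (ℕ-coprime.1-coprimeTo k))
  ℕ→ℚ≡mkℚ k = normalize-coprime (ℕ-coprime.sym (ℕ-coprime.1-coprimeTo k))

  ℕ→ℚ-+ : ∀ a b → ℕ→ℚ (a ℕ.+ b) ≡ ℕ→ℚ a + ℕ→ℚ b
  ℕ→ℚ-+ a b = sym (trans (cong₂ _+_ (ℕ→ℚ≡mkℚ a) (ℕ→ℚ≡mkℚ b)) (cong (_/ 1) +a+b))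
    where
    +a+b : ℤ.+ a ℤ.* ℤ.+ 1 ℤ.+ ℤ.+ b ℤ.* ℤ.+ 1 ≡ ℤ.+ (a ℕ.+ b)
    +a+b = trans (cong₂ ℤ._+_ (ℤ.*-identityʳ (ℤ.+ a)) (ℤ.*-identityʳ (ℤ.+ b))) (sym (ℤ.pos-+ a b))

  ℕ→ℚ-* : ∀ a b → ℕ→ℚ (a ℕ.* b) ≡ ℕ→ℚ a * ℕ→ℚ b
  ℕ→ℚ-* a b = sym (trans (cong₂ _*_ (ℕ→ℚ≡mkℚ a) (ℕ→ℚ≡mkℚ b)) (cong (_/ 1) (sym (ℤ.pos-* a b))))

  ℕ→ℚ-invertible : ∀ k → ∃[ r ] r * ℕ→ℚ (suc k) ≡ 1ℚ
  ℕ→ℚ-invertible k = 1/ q , trans (cong (1/ q *_) (ℕ→ℚ≡mkℚ (suc k))) (*-inverseˡ q)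
    where q = mkℚ (ℤ.+ suc k) 0 (ℕ-coprime.sym (ℕ-coprime.1-coprimeTo (suc k)))

  ∑-cong : ∀ n {f g : Fin n → ℚ} → (∀ k → f k ≡ g k) → ∑ n f ≡ ∑ n g
  ∑-cong zero    f≗g = refl
  ∑-cong (suc n) f≗g = cong₂ _+_ (f≗g Fin.zero) (∑-cong n (f≗g ∘ Fin.suc))

  ∑-zero : ∀ n → ∑ n (λ _ → 0ℚ) ≡ 0ℚ
  ∑-zero zero    = refl
  ∑-zero (suc n) = cong (0ℚ +_) (∑-zero n)

  ∑-distrib-+ : ∀ n (f g : Fin n → ℚ) → ∑ n (λ k → f k + g k) ≡ ∑ n f + ∑ n g
  ∑-distrib-+ zero    f g = refl
  ∑-distrib-+ (suc n) f g = trans (cong (f Fin.zero + g Fin.zero +_) (∑-distrib-+ n _ _))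
    (solve 4 (λ a b x y → (a :+ b) :+ (x :+ y) := (a :+ x) :+ (b :+ y)) refl
       (f Fin.zero) (g Fin.zero) (∑ n (λ k → f (Fin.suc k))) (∑ n (λ k → g (Fin.suc k))))

  ∑-distrib-- : ∀ n (f g : Fin n → ℚ) → ∑ n (λ k → f k - g k) ≡ ∑ n f - ∑ n g
  ∑-distrib-- zero    f g = refl
  ∑-distrib-- (suc n) f g = trans (cong (f Fin.zero - g Fin.zero +_) (∑-distrib-- n _ _))
    (solve 4 (λ a b x y → (a :- b) :+ (x :- y) := (a :+ x) :- (b :+ y)) refl
       (f Fin.zero) (g Fin.zero) (∑ n (λ k → f (Fin.suc k))) (∑ n (λ k → g (Fin.suc k))))

  *-distribˡ-∑ : ∀ n c (f : Fin n → ℚ) → c * ∑ n f ≡ ∑ n (λ k → c * f k)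
  *-distribˡ-∑ zero    c f = solve 1 (λ c → c :* con 0ℚ := con 0ℚ) refl c
  *-distribˡ-∑ (suc n) c f = trans
    (solve 3 (λ c a s → c :* (a :+ s) := c :* a :+ c :* s) refl c (f Fin.zero) (∑ n (λ k → f (Fin.suc k))))
    (cong (c * f Fin.zero +_) (*-distribˡ-∑ n c _))

  *-distribʳ-∑ : ∀ n c (f : Fin n → ℚ) → ∑ n f * c ≡ ∑ n (λ k → f k * c)
  *-distribʳ-∑ n c f = trans (*-comm (∑ n f) c)
    (trans (*-distribˡ-∑ n c f) (∑-cong n (λ k → *-comm c (f k))))

  ∑-comm : ∀ m n (f : Fin m → Fin n → ℚ) → ∑ m (λ i → ∑ n (f i)) ≡ ∑ n (λ j → ∑ m (λ i → f i j))
  ∑-comm zero    n f = sym (∑-zero n)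
  ∑-comm (suc m) n f = trans (cong (∑ n (f Fin.zero) +_) (∑-comm m n (λ i → f (Fin.suc i))))
    (sym (∑-distrib-+ n (f Fin.zero) (λ j → ∑ m (λ i → f (Fin.suc i) j))))

  ∑-δ : ∀ n (f : Fin n → ℚ) p → ∑ n (λ k → f k * Id n k p) ≡ f p
  ∑-δ (suc n) f Fin.zero = trans
    (cong (f Fin.zero * 1ℚ +_) (trans (∑-cong n (λ k → *-zeroʳ (f (Fin.suc k)))) (∑-zero n)))
    (solve 1 (λ x → x :* con 1ℚ :+ con 0ℚ := x) refl (f Fin.zero))
  ∑-δ (suc n) f (Fin.suc p) = trans (cong (f Fin.zero * 0ℚ +_) (∑-δ n (λ k → f (Fin.suc k)) p))
    (solve 2 (λ x y → x :* con 0ℚ :+ y := y) refl (f Fin.zero) (f (Fin.suc p)))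

  Id-sym : ∀ n i j → Id n i j ≡ Id n j i
  Id-sym n i j = cong 𝟙 (≡ᵇ-cong-⇔ {toℕ i} {toℕ j} (mk⇔ sym sym))

  ∑-δˡ : ∀ n (f : Fin n → ℚ) p → ∑ n (λ k → Id n p k * f k) ≡ f p
  ∑-δˡ n f p = trans (∑-cong n (λ k → trans (*-comm (Id n p k) (f k)) (cong (f k *_) (Id-sym n p k)))) (∑-δ n f p)

  ∑-one : ∀ n → ∑ n (λ _ → 1ℚ) ≡ ℕ→ℚ n
  ∑-one zero    = refl
  ∑-one (suc n) = trans (cong (1ℚ +_) (∑-one n)) (sym (ℕ→ℚ-+ 1 n))

  ≡ᴹ-setoid : ℕ → Setoid 0ℓ 0ℓ
  ≡ᴹ-setoid n = record
    { Carrier       = Mat n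
    ; _≈_           = _≡ᴹ_
    ; isEquivalence = record
      { refl  = λ i j → refl
      ; sym   = λ M≈N i j → sym (M≈N i j)
      ; trans = λ M≈N N≈P i j → trans (M≈N i j) (N≈P i j)
      }
    }

  Symmetric : ∀ {n} → Mat n → Set
  Symmetric M = (M ᵀ) ≡ᴹ M

  module _ {n : ℕ} where

    ·-congˡ : ∀ {M M′} (N : Mat n) → M ≡ᴹ M′ → (M · N) ≡ᴹ (M′ · N)
    ·-congˡ N M≈M′ i j = ∑-cong n (λ k → cong (_* N k j) (M≈M′ i k))

    ·-congʳ : ∀ (M : Mat n) {N N′} → N ≡ᴹ N′ → (M · N) ≡ᴹ (M · N′)
    ·-congʳ M N≈N′ i j = ∑-cong n (λ k → cong (M i k *_) (N≈N′ k j))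

    ⊖-cong : ∀ {M M′ N N′ : Mat n} → M ≡ᴹ M′ → N ≡ᴹ N′ → (M ⊖ N) ≡ᴹ (M′ ⊖ N′)
    ⊖-cong M≈M′ N≈N′ i j = cong₂ _-_ (M≈M′ i j) (N≈N′ i j)

    ⊖-congʳ : ∀ (M : Mat n) {N N′} → N ≡ᴹ N′ → (M ⊖ N) ≡ᴹ (M ⊖ N′)
    ⊖-congʳ M N≈N′ i j = cong (M i j -_) (N≈N′ i j)

    ⊕-cong : ∀ {M M′ N N′ : Mat n} → M ≡ᴹ M′ → N ≡ᴹ N′ → (M ⊕ N) ≡ᴹ (M′ ⊕ N′)
    ⊕-cong M≈M′ N≈N′ i j = cong₂ _+_ (M≈M′ i j) (N≈N′ i j)

    •-congˡ : ∀ c {M M′ : Mat n} → M ≡ᴹ M′ → (c • M) ≡ᴹ (c • M′)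
    •-congˡ c M≈M′ i j = cong (c *_) (M≈M′ i j)

    ᵀ-cong : ∀ {M M′ : Mat n} → M ≡ᴹ M′ → (M ᵀ) ≡ᴹ (M′ ᵀ)
    ᵀ-cong M≈M′ i j = M≈M′ j i

    ·-distribˡ-⊖ : ∀ (M N P : Mat n) → (M · (N ⊖ P)) ≡ᴹ ((M · N) ⊖ (M · P))
    ·-distribˡ-⊖ M N P i j = trans
      (∑-cong n (λ k → solve 3 (λ m x y → m :* (x :- y) := m :* x :- m :* y) refl (M i k) (N k j) (P k j)))
      (∑-distrib-- n _ _)

    ·-distribʳ-⊖ : ∀ (M N P : Mat n) → ((M ⊖ N) · P) ≡ᴹ ((M · P) ⊖ (N · P))
    ·-distribʳ-⊖ M N P i j = trans
      (∑-cong n (λ k → solve 3 (λ x y p → (x :- y) :* p := x :* p :- y :* p) refl (M i k) (N i k) (P k j)))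
      (∑-distrib-- n _ _)

    ·-distribʳ-⊕ : ∀ (M N P : Mat n) → ((M ⊕ N) · P) ≡ᴹ ((M · P) ⊕ (N · P))
    ·-distribʳ-⊕ M N P i j = trans
      (∑-cong n (λ k → solve 3 (λ x y p → (x :+ y) :* p := x :* p :+ y :* p) refl (M i k) (N i k) (P k j)))
      (∑-distrib-+ n _ _)

    •-·-assoc : ∀ c (M N : Mat n) → ((c • M) · N) ≡ᴹ (c • (M · N))
    •-·-assoc c M N i j = trans
      (∑-cong n (λ k → solve 3 (λ c m x → (c :* m) :* x := c :* (m :* x)) refl c (M i k) (N k j)))
      (sym (*-distribˡ-∑ n c _))

    ·-•-comm : ∀ c (M N : Mat n) → (M · (c • N)) ≡ᴹ (c • (M · N))
    ·-•-comm c M N i j = trans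
      (∑-cong n (λ k → solve 3 (λ c m x → m :* (c :* x) := c :* (m :* x)) refl c (M i k) (N k j)))
      (sym (*-distribˡ-∑ n c _))

    •-assoc : ∀ c c′ (M : Mat n) → (c • (c′ • M)) ≡ᴹ ((c * c′) • M)
    •-assoc c c′ M i j = sym (*-assoc c c′ (M i j))

    ·-identityˡ : ∀ (M : Mat n) → (Id n · M) ≡ᴹ M
    ·-identityˡ M i j = ∑-δˡ n (λ k → M k j) i

    ·-identityʳ : ∀ (M : Mat n) → (M · Id n) ≡ᴹ M
    ·-identityʳ M i j = ∑-δ n (M i) j

    ·-assoc : ∀ (M N P : Mat n) → ((M · N) · P) ≡ᴹ (M · (N · P))
    ·-assoc M N P i j = begin
      ∑ n (λ l → ∑ n (λ k → M i k * N k l) * P l j)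
        ≡⟨ ∑-cong n (λ l → *-distribʳ-∑ n (P l j) (λ k → M i k * N k l)) ⟩
      ∑ n (λ l → ∑ n (λ k → M i k * N k l * P l j))
        ≡⟨ ∑-comm n n _ ⟩
      ∑ n (λ k → ∑ n (λ l → M i k * N k l * P l j))
        ≡⟨ ∑-cong n (λ k → ∑-cong n (λ l → *-assoc (M i k) (N k l) (P l j))) ⟩
      ∑ n (λ k → ∑ n (λ l → M i k * (N k l * P l j)))
        ≡⟨ ∑-cong n (λ k → sym (*-distribˡ-∑ n (M i k) _)) ⟩
      ∑ n (λ k → M i k * ∑ n (λ l → N k l * P l j)) ∎
      where open ≡-Reasoning

    ᵀ-· : ∀ (M N : Mat n) → ((M · N) ᵀ) ≡ᴹ ((N ᵀ) · (M ᵀ))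
    ᵀ-· M N i j = ∑-cong n (λ k → *-comm (M j k) (N k i))

    J·J : (J n · J n) ≡ᴹ (ℕ→ℚ n • J n)
    J·J i j = trans (∑-cong n (λ _ → *-identityˡ 1ℚ)) (trans (∑-one n) (sym (*-identityʳ (ℕ→ℚ n))))

    ·[W⊖rJ]≡Id : ∀ {A W : Mat n} {ρ r} → (A · W) ≡ᴹ (Id n ⊕ J n) → (A · J n) ≡ᴹ (ρ • J n) →
                 r * ρ ≡ 1ℚ → (A · (W ⊖ (r • J n))) ≡ᴹ Id n
    ·[W⊖rJ]≡Id {A} {W} {ρ} {r} A·W A·J r*ρ≡1 = begin
      A · (W ⊖ (r • J n))             ≈⟨ ·-distribˡ-⊖ A W (r • J n) ⟩
      (A · W) ⊖ (A · (r • J n))       ≈⟨ ⊖-cong A·W (·-•-comm r A (J n)) ⟩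
      (Id n ⊕ J n) ⊖ (r • (A · J n))  ≈⟨ ⊖-congʳ (Id n ⊕ J n) (•-congˡ r A·J) ⟩
      (Id n ⊕ J n) ⊖ (r • (ρ • J n))  ≈⟨ cancel ⟩
      Id n                            ∎
      where
      open SetoidReasoning (≡ᴹ-setoid n)
      cancel : ((Id n ⊕ J n) ⊖ (r • (ρ • J n))) ≡ᴹ Id n
      cancel i j = trans
        (solve 3 (λ x r ρ → (x :+ con 1ℚ) :- r :* (ρ :* con 1ℚ) := x :+ (con 1ℚ :- r :* ρ)) refl (Id n i j) r ρ)
        (trans (cong (λ z → Id n i j + (1ℚ - z)) r*ρ≡1) (solve 1 (λ x → x :+ (con 1ℚ :- con 1ℚ) := x) refl (Id n i j)))

    symmetric-inverseʳ⇒inverseˡ : ∀ {A B : Mat n} → Symmetric A → Symmetric B → (A · B) ≡ᴹ Id n → (B · A) ≡ᴹ Id n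
    symmetric-inverseʳ⇒inverseˡ {A} {B} A-sym B-sym A·B = begin
      B · A             ≈⟨ ·-congˡ A B-sym ⟨
      (B ᵀ) · A         ≈⟨ ·-congʳ (B ᵀ) A-sym ⟨
      (B ᵀ) · (A ᵀ)     ≈⟨ ᵀ-· A B ⟨
      (A · B) ᵀ         ≈⟨ ᵀ-cong A·B ⟩
      Id n ᵀ            ≈⟨ (λ i j → Id-sym n j i) ⟩
      Id n              ∎
      where open SetoidReasoning (≡ᴹ-setoid n)

    quadratic-form : ∀ {A B : Mat n} {σ} α c → Symmetric B → (A · B) ≡ᴹ Id n → (J n · B) ≡ᴹ (σ • J n) →
      ((B ᵀ) · (((α • A) ⊖ (c • J n)) · B)) ≡ᴹ ((α • B) ⊖ ((c * (σ * σ)) • J n))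
    quadratic-form {A} {B} {σ} α c B-sym A·B J·B = begin
      Bᵀ · (((α • A) ⊖ (c • J n)) · B)
        ≈⟨ ·-congʳ Bᵀ (·-distribʳ-⊖ (α • A) (c • J n) B) ⟩
      Bᵀ · (((α • A) · B) ⊖ ((c • J n) · B))
        ≈⟨ ·-congʳ Bᵀ (⊖-cong (•-·-assoc α A B) (•-·-assoc c (J n) B)) ⟩
      Bᵀ · ((α • (A · B)) ⊖ (c • (J n · B)))
        ≈⟨ ·-congʳ Bᵀ (⊖-cong (•-congˡ α A·B) (•-congˡ c J·B)) ⟩
      Bᵀ · ((α • Id n) ⊖ (c • (σ • J n)))
        ≈⟨ ·-distribˡ-⊖ Bᵀ (α • Id n) (c • (σ • J n)) ⟩
      (Bᵀ · (α • Id n)) ⊖ (Bᵀ · (c • (σ • J n)))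
        ≈⟨ ⊖-cong (·-•-comm α Bᵀ (Id n)) (·-•-comm c Bᵀ (σ • J n)) ⟩
      (α • (Bᵀ · Id n)) ⊖ (c • (Bᵀ · (σ • J n)))
        ≈⟨ ⊖-cong (•-congˡ α (·-identityʳ Bᵀ)) (•-congˡ c (·-•-comm σ Bᵀ (J n))) ⟩
      (α • Bᵀ) ⊖ (c • (σ • (Bᵀ · J n)))
        ≈⟨ ⊖-cong (•-congˡ α B-sym) (•-congˡ c (•-congˡ σ Bᵀ·J)) ⟩
      (α • B) ⊖ (c • (σ • (σ • J n)))
        ≈⟨ ⊖-congʳ (α • B) (•-congˡ c (•-assoc σ σ (J n))) ⟩
      (α • B) ⊖ (c • ((σ * σ) • J n))
        ≈⟨ ⊖-congʳ (α • B) (•-assoc c (σ * σ) (J n)) ⟩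
      (α • B) ⊖ ((c * (σ * σ)) • J n)
        ∎
      where
      open SetoidReasoning (≡ᴹ-setoid n)
      Bᵀ : Mat n
      Bᵀ = B ᵀ
      Bᵀ·J : (Bᵀ · J n) ≡ᴹ (σ • J n)
      Bᵀ·J i j = trans (sym (ᵀ-· (J n) B i j)) (J·B j i)

    s•[A·J]≡[1+n]•J : ∀ {A W : Mat n} {s} → (A · W) ≡ᴹ (Id n ⊕ J n) → (W · J n) ≡ᴹ (s • J n) →
                      (s • (A · J n)) ≡ᴹ ((1ℚ + ℕ→ℚ n) • J n)
    s•[A·J]≡[1+n]•J {A} {W} {s} A·W W·J = begin
      s • (A · J n)              ≈⟨ ·-•-comm s A (J n) ⟨
      A · (s • J n)              ≈⟨ ·-congʳ A W·J ⟨
      A · (W · J n)              ≈⟨ ·-assoc A W (J n) ⟨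
      (A · W) · J n              ≈⟨ ·-congˡ (J n) A·W ⟩
      (Id n ⊕ J n) · J n         ≈⟨ ·-distribʳ-⊕ (Id n) (J n) (J n) ⟩
      (Id n · J n) ⊕ (J n · J n) ≈⟨ ⊕-cong (·-identityˡ (J n)) J·J ⟩
      J n ⊕ (ℕ→ℚ n • J n)        ≈⟨ (λ i j → collect (ℕ→ℚ n)) ⟩
      (1ℚ + ℕ→ℚ n) • J n         ∎
      where
      open SetoidReasoning (≡ᴹ-setoid n)
      collect : ∀ x → 1ℚ + x * 1ℚ ≡ (1ℚ + x) * 1ℚ
      collect = solve 1 (λ x → con 1ℚ :+ x :* con 1ℚ := (con 1ℚ :+ x) :* con 1ℚ) refl

    symmetric⇒·J≡J· : ∀ {W : Mat n} {s} → Symmetric W → (J n · W) ≡ᴹ (s • J n) → (W · J n) ≡ᴹ (s • J n)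
    symmetric⇒·J≡J· {W} W-sym J·W i j = trans (·-congˡ (J n) (λ k l → sym (W-sym k l)) i j)
      (trans (sym (ᵀ-· (J n) W i j)) (J·W j i))

    J·[W⊖rJ] : ∀ {W : Mat n} {s} r → (J n · W) ≡ᴹ (s • J n) →
               (J n · (W ⊖ (r • J n))) ≡ᴹ ((s - r * ℕ→ℚ n) • J n)
    J·[W⊖rJ] {W} {s} r J·W = begin
      J n · (W ⊖ (r • J n))              ≈⟨ ·-distribˡ-⊖ (J n) W (r • J n) ⟩
      (J n · W) ⊖ (J n · (r • J n))      ≈⟨ ⊖-cong J·W (·-•-comm r (J n) (J n)) ⟩
      (s • J n) ⊖ (r • (J n · J n))      ≈⟨ ⊖-congʳ (s • J n) (•-congˡ r J·J) ⟩
      (s • J n) ⊖ (r • (ℕ→ℚ n • J n))    ≈⟨ (λ i j → collect s r (ℕ→ℚ n)) ⟩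
      (s - r * ℕ→ℚ n) • J n              ∎
      where
      open SetoidReasoning (≡ᴹ-setoid n)
      collect : ∀ s r x → s * 1ℚ - r * (x * 1ℚ) ≡ (s - r * x) * 1ℚ
      collect = solve 3 (λ s r x → s :* con 1ℚ :- r :* (x :* con 1ℚ) := (s :- r :* x) :* con 1ℚ) refl

  3-r*n≡r : ∀ d n r → r * d ≡ 1ℚ → 1ℚ + n ≡ ℕ→ℚ 3 * d → ℕ→ℚ 3 - r * n ≡ r
  3-r*n≡r d n r r*d≡1 1+n≡3*d = begin
    three - r * n
      ≡⟨ solve 3 (λ r n t → t :- r :* n := (t :- r :* (con 1ℚ :+ n)) :+ r) refl r n three ⟩
    (three - r * (1ℚ + n)) + r
      ≡⟨ cong (λ z → (three - r * z) + r) 1+n≡3*d ⟩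
    (three - r * (three * d)) + r
      ≡⟨ solve 3 (λ r d t → (t :- r :* (t :* d)) :+ r := (t :- t :* (r :* d)) :+ r) refl r d three ⟩
    (three - three * (r * d)) + r
      ≡⟨ cong (λ z → (three - three * z) + r) r*d≡1 ⟩
    (three - three * 1ℚ) + r
      ≡⟨ solve 1 (λ r → (con three :- con three :* con 1ℚ) :+ r := r) refl r ⟩
    r ∎
    where
    open ≡-Reasoning
    three : ℚ
    three = ℕ→ℚ 3

  ½r+c*r*r≡½ : ∀ d k r c → r * d ≡ 1ℚ → d ≡ 1ℚ + k → c + c ≡ d * k → ½ * r + c * (r * r) ≡ ½
  ½r+c*r*r≡½ d k r c r*d≡1 d≡1+k c+c≡d*k = begin
    ½ * r + c * (r * r)
      ≡⟨ solve 2 (λ r c → con ½ :* r :+ c :* (r :* r) := con ½ :* r :+ con ½ :* (c :+ c) :* (r :* r)) refl r c ⟩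
    ½ * r + ½ * (c + c) * (r * r)
      ≡⟨ cong (λ z → ½ * r + ½ * z * (r * r)) c+c≡d*k ⟩
    ½ * r + ½ * (d * k) * (r * r)
      ≡⟨ solve 3 (λ r d k → con ½ :* r :+ con ½ :* (d :* k) :* (r :* r)
                         := con ½ :* r :* (con 1ℚ :+ k :* (r :* d))) refl r d k ⟩
    ½ * r * (1ℚ + k * (r * d))
      ≡⟨ cong (λ z → ½ * r * (1ℚ + k * z)) r*d≡1 ⟩
    ½ * r * (1ℚ + k * 1ℚ)
      ≡⟨ solve 2 (λ r k → con ½ :* r :* (con 1ℚ :+ k :* con 1ℚ) := con ½ :* (r :* (con 1ℚ :+ k))) refl r k ⟩
    ½ * (r * (1ℚ + k))
      ≡⟨ cong (λ z → ½ * (r * z)) (sym d≡1+k) ⟩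
    ½ * (r * d)
      ≡⟨ cong (½ *_) r*d≡1 ⟩
    ½ * 1ℚ
      ≡⟨ *-identityʳ ½ ⟩
    ½ ∎
    where open ≡-Reasoning

  [1+k]C2+[1+k]C2≡[1+k]*k : ∀ k → suc k C 2 ℕ.+ suc k C 2 ≡ suc k ℕ.* k
  [1+k]C2+[1+k]C2≡[1+k]*k zero    = refl
  [1+k]C2+[1+k]C2≡[1+k]*k (suc k) = begin
    (2+k C 2) ℕ.+ (2+k C 2)                   ≡⟨ cong (λ z → z ℕ.+ z) (sym (nCk+nC[k+1]≡[n+1]C[k+1] (suc k) 1)) ⟩
    (1+k C 1 ℕ.+ 1+k C 2) ℕ.+ (1+k C 1 ℕ.+ 1+k C 2) ≡⟨ cong (λ z → (z ℕ.+ 1+k C 2) ℕ.+ (z ℕ.+ 1+k C 2)) (nC1≡n 1+k) ⟩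
    (1+k ℕ.+ 1+k C 2) ℕ.+ (1+k ℕ.+ 1+k C 2)   ≡⟨ interchange 1+k (1+k C 2) ⟩
    1+k ℕ.+ 1+k ℕ.+ (1+k C 2 ℕ.+ 1+k C 2)     ≡⟨ cong (1+k ℕ.+ 1+k ℕ.+_) ([1+k]C2+[1+k]C2≡[1+k]*k k) ⟩
    1+k ℕ.+ 1+k ℕ.+ 1+k ℕ.* k                 ≡⟨ expand k ⟩
    2+k ℕ.* 1+k                               ∎
    where
    open ≡-Reasoning
    1+k 2+k : ℕ
    1+k = suc k
    2+k = suc (suc k)
    interchange : ∀ a b → (a ℕ.+ b) ℕ.+ (a ℕ.+ b) ≡ a ℕ.+ a ℕ.+ (b ℕ.+ b)
    interchange = ℕ-solve.solve-∀
    expand : ∀ k → suc k ℕ.+ suc k ℕ.+ suc k ℕ.* k ≡ suc (suc k) ℕ.* suc k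
    expand = ℕ-solve.solve-∀

  module InverseFromW {k n : ℕ} {A W : Mat n} (n≡3k+2 : n ≡ 3 ℕ.* k ℕ.+ 2)
    (A-sym : Symmetric A) (W-sym : Symmetric W)
    (A·W : (A · W) ≡ᴹ (Id n ⊕ J n)) (J·W : (J n · W) ≡ᴹ (ℕ→ℚ 3 • J n)) where

    d : ℚ
    d = ℕ→ℚ (suc k)

    r : ℚ
    r = proj₁ (ℕ→ℚ-invertible k)

    r*d≡1 : r * d ≡ 1ℚ
    r*d≡1 = proj₂ (ℕ→ℚ-invertible k)

    B : Mat n
    B = W ⊖ (r • J n)

    B-sym : Symmetric B
    B-sym i j = cong (_- r * 1ℚ) (W-sym i j)

    1+n≡3*d : 1ℚ + ℕ→ℚ n ≡ ℕ→ℚ 3 * d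
    1+n≡3*d = trans (sym (ℕ→ℚ-+ 1 n)) (trans (cong ℕ→ℚ (trans (cong suc n≡3k+2) (3k+3≡3[1+k] k))) (ℕ→ℚ-* 3 (suc k)))
      where
      3k+3≡3[1+k] : ∀ k → suc (3 ℕ.* k ℕ.+ 2) ≡ 3 ℕ.* suc k
      3k+3≡3[1+k] = ℕ-solve.solve-∀

    A·J≡d•J : (A · J n) ≡ᴹ (d • J n)
    A·J≡d•J i j = begin
      (A · J n) i j                 ≡⟨ solve 1 (λ x → x := con ⅓ :* (con (ℕ→ℚ 3) :* x)) refl ((A · J n) i j) ⟩
      ⅓ * (ℕ→ℚ 3 * (A · J n) i j)   ≡⟨ cong (⅓ *_) (s•[A·J]≡[1+n]•J {A = A} {W = W} {s = ℕ→ℚ 3} A·W W·J i j) ⟩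
      ⅓ * ((1ℚ + ℕ→ℚ n) * 1ℚ)       ≡⟨ cong (λ z → ⅓ * (z * 1ℚ)) 1+n≡3*d ⟩
      ⅓ * (ℕ→ℚ 3 * d * 1ℚ)          ≡⟨ solve 1 (λ d → con ⅓ :* (con (ℕ→ℚ 3) :* d :* con 1ℚ) := d :* con 1ℚ) refl d ⟩
      d * 1ℚ                        ∎
      where
      open ≡-Reasoning
      ⅓ : ℚ
      ⅓ = 1/ ℕ→ℚ 3
      W·J : (W · J n) ≡ᴹ (ℕ→ℚ 3 • J n)
      W·J = symmetric⇒·J≡J· {W = W} {s = ℕ→ℚ 3} W-sym J·W

    A·B≡Id : (A · B) ≡ᴹ Id n
    A·B≡Id = ·[W⊖rJ]≡Id {A = A} {W = W} {ρ = d} {r = r} A·W A·J≡d•J r*d≡1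

    B·A≡Id : (B · A) ≡ᴹ Id n
    B·A≡Id = symmetric-inverseʳ⇒inverseˡ {A = A} {B = B} A-sym B-sym A·B≡Id

    J·B≡r•J : (J n · B) ≡ᴹ (r • J n)
    J·B≡r•J i j = trans (J·[W⊖rJ] {W = W} r J·W i j) (cong (_* 1ℚ) (3-r*n≡r d (ℕ→ℚ n) r r*d≡1 1+n≡3*d))

    Bᵀ[½A⊖cJ]B≡½[W⊖J] : ((B ᵀ) · (((½ • A) ⊖ (ℕ→ℚ (suc k C 2) • J n)) · B)) ≡ᴹ (½ • (W ⊖ J n))
    Bᵀ[½A⊖cJ]B≡½[W⊖J] i j = trans (quadratic-form {A = A} {B = B} {σ = r} ½ c B-sym A·B≡Id J·B≡r•J i j) (begin
      ½ * (W i j - r * 1ℚ) - c * (r * r) * 1ℚ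
        ≡⟨ solve 3 (λ w r x → con ½ :* (w :- r :* con 1ℚ) :- x :* con 1ℚ := con ½ :* w :- (con ½ :* r :+ x))
             refl (W i j) r (c * (r * r)) ⟩
      ½ * W i j - (½ * r + c * (r * r))
        ≡⟨ cong (½ * W i j -_) (½r+c*r*r≡½ d (ℕ→ℚ k) r c r*d≡1 (ℕ→ℚ-+ 1 k) c+c≡d*k) ⟩
      ½ * W i j - ½
        ≡⟨ solve 1 (λ w → con ½ :* w :- con ½ := con ½ :* (w :- con 1ℚ)) refl (W i j) ⟩
      ½ * (W i j - 1ℚ) ∎)
      where
      open ≡-Reasoning
      c : ℚ
      c = ℕ→ℚ (suc k C 2)
      c+c≡d*k : c + c ≡ d * ℕ→ℚ k
      c+c≡d*k = trans (sym (ℕ→ℚ-+ (suc k C 2) (suc k C 2)))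
        (trans (cong ℕ→ℚ ([1+k]C2+[1+k]C2≡[1+k]*k k)) (ℕ→ℚ-* (suc k) k))

open Matrices

module Circulants where

  open import Data.Nat using (_+_; _*_; _∸_; _<_; _≤ᵇ_; _≤?_; _<?_; NonZero; z≤n; s≤s⁻¹; z<s; ⌈_/2⌉; ⌊_/2⌋)
  open import Data.Nat.Properties
  open import Data.Nat.DivMod
    using (_%_; _/_; m%n<n; m<n⇒m%n≡m; [m+n]%n≡m%n; [m+kn]%n≡m%n; %-distribˡ-+; m%n%n≡m%n; m≡m%n+[m/n]*n; n%n≡0)
  open import Data.Nat.Tactic.RingSolver using (solve-∀)
  open import Data.Bool using (true; false; _∨_)
  open import Data.Bool.Properties using (T-∨)
  open import Data.Bool.ListAction using (any)
  open import Data.List using (upTo)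
  open import Data.List.Relation.Unary.Any.Properties using (any⁺; any⁻)
  open import Data.List.Membership.Propositional using (find; lose)
  open import Data.List.Membership.Propositional.Properties using (∈-upTo⁺; ∈-upTo⁻)
  open import Data.Fin using (Fin; toℕ; fromℕ<)
  open import Data.Fin.Properties using (toℕ<n; toℕ-fromℕ<; toℕ-injective)
  open import Data.Product using (∃-syntax)
  open import Data.Sum as Sum using (_⊎_; inj₁; inj₂)
  open import Data.Sum.Function.Propositional using (_⊎-⇔_)
  open import Data.Rational as ℚ using ()
  open import Data.Rational.Solver using (module +-*-Solver)
  open +-*-Solver using (solve; _:+_; _:*_; _:=_)
  open import Function using (_∘_; Equivalence)
  open import Function.Related.Propositional using (module EquationalReasoning; Kind)
  open import Relation.Nullary using (yes; no; contradiction; ofʸ; ofⁿ)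
  open import Relation.Binary.Definitions using (tri<; tri≈; tri>)
  open import Relation.Binary.PropositionalEquality hiding (J)

  diffmod-≤ : ∀ {n} (i j : Fin n) → toℕ i ≤ toℕ j → diffmod n i j ≡ toℕ j ∸ toℕ i
  diffmod-≤ i j i≤j with toℕ i ≤ᵇ toℕ j | ≤ᵇ-reflects-≤ (toℕ i) (toℕ j)
  ... | true  | _        = refl
  ... | false | ofⁿ i≰j = contradiction i≤j i≰j

  diffmod-> : ∀ {n} (i j : Fin n) → toℕ j < toℕ i → diffmod n i j ≡ (n ∸ toℕ i) + toℕ j
  diffmod-> i j j<i with toℕ i ≤ᵇ toℕ j | ≤ᵇ-reflects-≤ (toℕ i) (toℕ j)
  ... | true  | ofʸ i≤j = contradiction i≤j (<⇒≱ j<i)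
  ... | false | _       = refl

  diffmod<n : ∀ {n} (i j : Fin n) → diffmod n i j < n
  diffmod<n {n} i j with toℕ i ≤? toℕ j
  ... | yes i≤j = subst (_< n) (sym (diffmod-≤ i j i≤j)) (≤-<-trans (m∸n≤m (toℕ j) (toℕ i)) (toℕ<n j))
  ... | no  i≰j = subst (_< n) (sym (diffmod-> i j j<i)) (begin-strict
        (n ∸ toℕ i) + toℕ j   <⟨ +-monoʳ-< (n ∸ toℕ i) j<i ⟩
        (n ∸ toℕ i) + toℕ i   ≡⟨ m∸n+n≡m (<⇒≤ (toℕ<n i)) ⟩
        n                     ∎)
    where
    open ≤-Reasoning
    j<i : toℕ j < toℕ i
    j<i = ≰⇒> i≰j

  diffmod-self : ∀ {n} (i : Fin n) → diffmod n i i ≡ 0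
  diffmod-self i = trans (diffmod-≤ i i ≤-refl) (n∸n≡0 (toℕ i))

  diffmod+diffmod≡n : ∀ {n} {i j : Fin n} → toℕ i < toℕ j → diffmod n i j + diffmod n j i ≡ n
  diffmod+diffmod≡n {n} {i} {j} i<j = begin
    diffmod n i j + diffmod n j i           ≡⟨ cong₂ _+_ (diffmod-≤ i j (<⇒≤ i<j)) (diffmod-> j i i<j) ⟩
    (j′ ∸ i′) + ((n ∸ j′) + i′)             ≡⟨ cong ((j′ ∸ i′) +_) (+-comm (n ∸ j′) i′) ⟩
    (j′ ∸ i′) + (i′ + (n ∸ j′))             ≡⟨ +-assoc (j′ ∸ i′) i′ (n ∸ j′) ⟨
    (j′ ∸ i′) + i′ + (n ∸ j′)               ≡⟨ cong (_+ (n ∸ j′)) (m∸n+n≡m (<⇒≤ i<j)) ⟩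
    j′ + (n ∸ j′)                           ≡⟨ m+[n∸m]≡n (<⇒≤ (toℕ<n j)) ⟩
    n                                       ∎
    where
    open ≡-Reasoning
    i′ j′ : ℕ
    i′ = toℕ i
    j′ = toℕ j

  diffmod-antisym : ∀ {n} (i j : Fin n) → diffmod n i j + diffmod n j i ≡ 0 ⊎ diffmod n i j + diffmod n j i ≡ n
  diffmod-antisym {n} i j with <-cmp (toℕ i) (toℕ j)
  ... | tri< i<j _ _ = inj₂ (diffmod+diffmod≡n i<j)
  ... | tri> _ _ j<i = inj₂ (trans (+-comm (diffmod n i j) _) (diffmod+diffmod≡n j<i))
  ... | tri≈ _ i≡j _ rewrite toℕ-injective i≡j = inj₁ (cong₂ _+_ (diffmod-self j) (diffmod-self j))

  module _ {n : ℕ} .{{_ : NonZero n}} where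

    [m%n+k]%n≡[m+k]%n : ∀ m k → ((m % n) + k) % n ≡ (m + k) % n
    [m%n+k]%n≡[m+k]%n m k = begin
      ((m % n) + k) % n             ≡⟨ %-distribˡ-+ (m % n) k n ⟩
      ((m % n % n) + k % n) % n     ≡⟨ cong (λ z → (z + k % n) % n) (m%n%n≡m%n m n) ⟩
      ((m % n) + k % n) % n         ≡⟨ %-distribˡ-+ m k n ⟨
      (m + k) % n                   ∎
      where open ≡-Reasoning

    diffmod≡% : ∀ (i j : Fin n) → diffmod n i j ≡ (toℕ j + (n ∸ toℕ i)) % n
    diffmod≡% i j with toℕ i ≤? toℕ j
    ... | yes i≤j = begin
      diffmod n i j                     ≡⟨ diffmod-≤ i j i≤j ⟩
      toℕ j ∸ toℕ i                     ≡⟨ m<n⇒m%n≡m (≤-<-trans (m∸n≤m (toℕ j) (toℕ i)) (toℕ<n j)) ⟨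
      (toℕ j ∸ toℕ i) % n               ≡⟨ [m+n]%n≡m%n (toℕ j ∸ toℕ i) n ⟨
      ((toℕ j ∸ toℕ i) + n) % n         ≡⟨ cong (_% n) (+-∸-comm n i≤j) ⟨
      ((toℕ j + n) ∸ toℕ i) % n         ≡⟨ cong (_% n) (+-∸-assoc (toℕ j) (<⇒≤ (toℕ<n i))) ⟩
      (toℕ j + (n ∸ toℕ i)) % n         ∎
      where open ≡-Reasoning
    ... | no i≰j = begin
      diffmod n i j                     ≡⟨ diffmod-> i j j<i ⟩
      (n ∸ toℕ i) + toℕ j               ≡⟨ +-comm (n ∸ toℕ i) (toℕ j) ⟩
      toℕ j + (n ∸ toℕ i)               ≡⟨ m<n⇒m%n≡m j+[n∸i]<n ⟨
      (toℕ j + (n ∸ toℕ i)) % n         ∎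
      where
      open ≡-Reasoning
      j<i : toℕ j < toℕ i
      j<i = ≰⇒> i≰j
      j+[n∸i]<n : toℕ j + (n ∸ toℕ i) < n
      j+[n∸i]<n = subst (_< n) (trans (diffmod-> i j j<i) (+-comm (n ∸ toℕ i) (toℕ j))) (diffmod<n i j)

    shift : ℕ → Fin n → Fin n
    shift c j = fromℕ< (m%n<n (c + toℕ j) n)

    diffmod-shift : ∀ c (i j : Fin n) → diffmod n i (shift c j) ≡ (diffmod n i j + c) % n
    diffmod-shift c i j = begin
      diffmod n i (shift c j)                  ≡⟨ diffmod≡% i (shift c j) ⟩
      (toℕ (shift c j) + (n ∸ toℕ i)) % n      ≡⟨ cong (λ z → (z + (n ∸ toℕ i)) % n) (toℕ-fromℕ< _) ⟩
      ((c + toℕ j) % n + (n ∸ toℕ i)) % n      ≡⟨ [m%n+k]%n≡[m+k]%n (c + toℕ j) (n ∸ toℕ i) ⟩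
      (c + toℕ j + (n ∸ toℕ i)) % n            ≡⟨ cong (_% n) (rotate c (toℕ j) (n ∸ toℕ i)) ⟩
      (toℕ j + (n ∸ toℕ i) + c) % n            ≡⟨ [m%n+k]%n≡[m+k]%n (toℕ j + (n ∸ toℕ i)) c ⟨
      ((toℕ j + (n ∸ toℕ i)) % n + c) % n      ≡⟨ cong (λ z → (z + c) % n) (diffmod≡% i j) ⟨
      (diffmod n i j + c) % n                  ∎
      where
      open ≡-Reasoning
      rotate : ∀ a b c → a + b + c ≡ b + c + a
      rotate = solve-∀

    diffmod≡c⇔ : ∀ {c} (j k : Fin n) → c < n → (diffmod n j k ≡ c) ⇔ (toℕ k ≡ toℕ (shift c j))
    diffmod≡c⇔ {c} j k c<n = mk⇔ to from
      where
      open ≡-Reasoning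
      to : diffmod n j k ≡ c → toℕ k ≡ toℕ (shift c j)
      to D≡c = begin
        toℕ k                                   ≡⟨ m<n⇒m%n≡m (toℕ<n k) ⟨
        toℕ k % n                               ≡⟨ [m+n]%n≡m%n (toℕ k) n ⟨
        (toℕ k + n) % n                         ≡⟨ cong (λ z → (toℕ k + z) % n) (m∸n+n≡m (<⇒≤ (toℕ<n j))) ⟨
        (toℕ k + ((n ∸ toℕ j) + toℕ j)) % n     ≡⟨ cong (_% n) (+-assoc (toℕ k) (n ∸ toℕ j) (toℕ j)) ⟨
        (toℕ k + (n ∸ toℕ j) + toℕ j) % n       ≡⟨ [m%n+k]%n≡[m+k]%n (toℕ k + (n ∸ toℕ j)) (toℕ j) ⟨
        ((toℕ k + (n ∸ toℕ j)) % n + toℕ j) % n ≡⟨ cong (λ z → (z + toℕ j) % n) (trans (sym (diffmod≡% j k)) D≡c) ⟩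
        (c + toℕ j) % n                         ≡⟨ toℕ-fromℕ< _ ⟨
        toℕ (shift c j)                         ∎
      from : toℕ k ≡ toℕ (shift c j) → diffmod n j k ≡ c
      from k≡shift = begin
        diffmod n j k            ≡⟨ cong (diffmod n j) (toℕ-injective k≡shift) ⟩
        diffmod n j (shift c j)  ≡⟨ diffmod-shift c j j ⟩
        (diffmod n j j + c) % n  ≡⟨ cong (λ z → (z + c) % n) (diffmod-self j) ⟩
        c % n                    ≡⟨ m<n⇒m%n≡m c<n ⟩
        c                        ∎

    shift-zero : ∀ (j : Fin n) → shift 0 j ≡ j
    shift-zero j = toℕ-injective (trans (toℕ-fromℕ< _) (m<n⇒m%n≡m (toℕ<n j)))

    𝟙-diffmod≡ᵇ : ∀ {c} (j k : Fin n) → c < n → 𝟙 (diffmod n j k ≡ᵇ c) ≡ Id n k (shift c j)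
    𝟙-diffmod≡ᵇ {c} j k c<n = cong 𝟙 (≡ᵇ-cong-⇔ {diffmod n j k} {c} {toℕ k} {toℕ (shift c j)} (diffmod≡c⇔ j k c<n))

    Id≡𝟙[diffmod≡ᵇ0] : ∀ (i j : Fin n) → Id n i j ≡ 𝟙 (diffmod n i j ≡ᵇ 0)
    Id≡𝟙[diffmod≡ᵇ0] i j = trans (Id-sym n i j)
      (sym (trans (𝟙-diffmod≡ᵇ i j (≤-<-trans z≤n (toℕ<n i))) (cong (Id n j) (shift-zero i))))

  Circulant : ∀ {n} → (ℕ → ℚ) → Mat n → Set
  Circulant {n} f M = ∀ i j → M i j ≡ f (diffmod n i j)

  circulant-sym : ∀ {n} {f : ℕ → ℚ} {M : Mat n} → Circulant f M →
    (∀ {D D′} → D < n → D′ < n → D + D′ ≡ n → f D ≡ f D′) → Symmetric M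
  circulant-sym {n} {f} M≡f f-sym i j = trans (M≡f j i) (trans symbol-sym (sym (M≡f i j)))
    where
    symbol-sym : f (diffmod n j i) ≡ f (diffmod n i j)
    symbol-sym with diffmod-antisym j i
    ... | inj₁ sum≡0 = cong f (trans (m+n≡0⇒m≡0 _ sum≡0) (sym (m+n≡0⇒n≡0 _ sum≡0)))
    ... | inj₂ sum≡n = f-sym (diffmod<n j i) (diffmod<n i j) sum≡n

  W-symbol : ℕ → ℕ → Bool
  W-symbol n D = (D ≡ᵇ 0) ∨ (D ≡ᵇ 1) ∨ (D + 1 ≡ᵇ n)

  W-circulant : ∀ n → Circulant (𝟙 ∘ W-symbol n) (W n)
  W-circulant n i j = refl

  W-symbol⇔ : ∀ {n D} → T (W-symbol n D) ⇔ (D ≡ 0 ⊎ D ≡ 1 ⊎ D + 1 ≡ n)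
  W-symbol⇔ {n} {D} = mk⇔
    (Sum.map (≡ᵇ⇒≡ D 0) (Sum.map (≡ᵇ⇒≡ D 1) (≡ᵇ⇒≡ (D + 1) n) ∘ Equivalence.to T-∨) ∘ Equivalence.to T-∨)
    (Equivalence.from T-∨ ∘ Sum.map (≡⇒≡ᵇ D 0) (Equivalence.from T-∨ ∘ Sum.map (≡⇒≡ᵇ D 1) (≡⇒≡ᵇ (D + 1) n)))

  W-symbol-complement : ∀ {n D D′} → D′ < n → D + D′ ≡ n →
    (D ≡ 0 ⊎ D ≡ 1 ⊎ D + 1 ≡ n) → (D′ ≡ 0 ⊎ D′ ≡ 1 ⊎ D′ + 1 ≡ n)
  W-symbol-complement D′<n D′≡n (inj₁ refl) = contradiction D′≡n (<⇒≢ D′<n)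
  W-symbol-complement {D′ = D′} D′<n 1+D′≡n (inj₂ (inj₁ refl)) = inj₂ (inj₂ (trans (+-comm D′ 1) 1+D′≡n))
  W-symbol-complement {D = D} {D′} D′<n D+D′≡n (inj₂ (inj₂ D+1≡n)) =
    inj₂ (inj₁ (+-cancelˡ-≡ D D′ 1 (trans D+D′≡n (sym D+1≡n))))

  W-sym : ∀ n → Symmetric (W n)
  W-sym n = circulant-sym (W-circulant n) W-symbol-sym
    where
    W-symbol-sym : ∀ {D D′} → D < n → D′ < n → D + D′ ≡ n → 𝟙 (W-symbol n D) ≡ 𝟙 (W-symbol n D′)
    W-symbol-sym {D} {D′} D<n D′<n D+D′≡n = cong 𝟙 (T-⇔⇒≡ (⇔.trans W-symbol⇔ (⇔.trans
      (mk⇔ (W-symbol-complement D′<n D+D′≡n) (W-symbol-complement D<n (trans (+-comm D′ D) D+D′≡n)))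
      (⇔.sym W-symbol⇔))))

  W-symbol-split : ∀ {n} → 3 ≤ n → ∀ D →
                   𝟙 (W-symbol n D) ≡ 𝟙 (D ≡ᵇ 0) ℚ.+ 𝟙 (D ≡ᵇ 1) ℚ.+ 𝟙 (D + 1 ≡ᵇ n)
  W-symbol-split (s≤s (s≤s (s≤s _))) zero          = refl
  W-symbol-split (s≤s (s≤s (s≤s _))) (suc zero)    = refl
  W-symbol-split {n} (s≤s (s≤s (s≤s _))) (suc (suc D)) with suc (suc D) + 1 ≡ᵇ n
  ... | true  = refl
  ... | false = refl

  module _ {n : ℕ} .{{_ : NonZero n}} (3≤n : 3 ≤ n) where

    W-decomposition : ∀ k j → W n k j ≡ Id n k j ℚ.+ Id n k (shift 1 j) ℚ.+ Id n k (shift (n ∸ 1) j)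
    W-decomposition k j = begin
      W n k j
        ≡⟨ W-sym n j k ⟩
      W n j k
        ≡⟨ W-symbol-split 3≤n D ⟩
      𝟙 (D ≡ᵇ 0) ℚ.+ 𝟙 (D ≡ᵇ 1) ℚ.+ 𝟙 (D + 1 ≡ᵇ n)
        ≡⟨ cong (λ b → 𝟙 (D ≡ᵇ 0) ℚ.+ 𝟙 (D ≡ᵇ 1) ℚ.+ 𝟙 b) D+1≡ᵇn ⟩
      𝟙 (D ≡ᵇ 0) ℚ.+ 𝟙 (D ≡ᵇ 1) ℚ.+ 𝟙 (D ≡ᵇ n ∸ 1)
        ≡⟨ cong₂ ℚ._+_ (cong₂ ℚ._+_ δ₀ (𝟙-diffmod≡ᵇ j k 1<n)) (𝟙-diffmod≡ᵇ j k n∸1<n) ⟩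
      Id n k j ℚ.+ Id n k (shift 1 j) ℚ.+ Id n k (shift (n ∸ 1) j) ∎
      where
      open ≡-Reasoning
      D : ℕ
      D = diffmod n j k
      1≤n : 1 ≤ n
      1≤n = ≤-trans (s≤s z≤n) 3≤n
      1<n : 1 < n
      1<n = ≤-trans (s≤s (s≤s z≤n)) 3≤n
      n∸1<n : n ∸ 1 < n
      n∸1<n = ∸-monoʳ-< {n} {1} {0} z<s 1≤n
      δ₀ : 𝟙 (D ≡ᵇ 0) ≡ Id n k j
      δ₀ = trans (sym (Id≡𝟙[diffmod≡ᵇ0] j k)) (Id-sym n j k)
      D+1≡ᵇn : (D + 1 ≡ᵇ n) ≡ (D ≡ᵇ n ∸ 1)
      D+1≡ᵇn = ≡ᵇ-cong-⇔ {D + 1} {n} {D} {n ∸ 1} (mk⇔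
        (λ D+1≡n → trans (sym (m+n∸n≡m D 1)) (cong (_∸ 1) D+1≡n))
        (λ D≡n∸1 → trans (cong (_+ 1) D≡n∸1) (m∸n+n≡m 1≤n)))

    ·-W : ∀ (M : Mat n) i j → (M · W n) i j ≡ M i j ℚ.+ M i (shift 1 j) ℚ.+ M i (shift (n ∸ 1) j)
    ·-W M i j = begin
      ∑ n (λ k → M i k ℚ.* W n k j)
        ≡⟨ ∑-cong n (λ k → trans (cong (M i k ℚ.*_) (W-decomposition k j)) (distrib₃ (M i k) _ _ _)) ⟩
      ∑ n (λ k → M i k ℚ.* Id n k j ℚ.+ M i k ℚ.* Id n k p ℚ.+ M i k ℚ.* Id n k q)
        ≡⟨ trans (∑-distrib-+ n _ _) (cong (ℚ._+ ∑ n (λ k → M i k ℚ.* Id n k q)) (∑-distrib-+ n _ _)) ⟩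
      ∑ n (λ k → M i k ℚ.* Id n k j) ℚ.+ ∑ n (λ k → M i k ℚ.* Id n k p) ℚ.+ ∑ n (λ k → M i k ℚ.* Id n k q)
        ≡⟨ cong₂ ℚ._+_ (cong₂ ℚ._+_ (∑-δ n (M i) j) (∑-δ n (M i) p)) (∑-δ n (M i) q) ⟩
      M i j ℚ.+ M i p ℚ.+ M i q ∎
      where
      open ≡-Reasoning
      p q : Fin n
      p = shift 1 j
      q = shift (n ∸ 1) j
      distrib₃ : ∀ x a b c → x ℚ.* (a ℚ.+ b ℚ.+ c) ≡ x ℚ.* a ℚ.+ x ℚ.* b ℚ.+ x ℚ.* c
      distrib₃ = solve 4 (λ x a b c → x :* (a :+ b :+ c) := x :* a :+ x :* b :+ x :* c) refl

    J·W : (J n · W n) ≡ᴹ (ℕ→ℚ 3 • J n)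
    J·W = ·-W (J n)

    circulant·W : ∀ {f} {M : Mat n} → Circulant f M → ∀ i j → let D = diffmod n i j in
      (M · W n) i j ≡ f D ℚ.+ f ((D + 1) % n) ℚ.+ f ((D + (n ∸ 1)) % n)
    circulant·W {f} {M} M≡f i j = trans (·-W M i j) (cong₂ ℚ._+_ (cong₂ ℚ._+_ (M≡f i j) (shifted 1)) (shifted (n ∸ 1)))
      where
      shifted : ∀ c → M i (shift c j) ≡ f ((diffmod n i j + c) % n)
      shifted c = trans (M≡f i (shift c j)) (cong f (diffmod-shift c i j))

  oneMod3 : ℕ → ℚ
  oneMod3 D = 𝟙 (D % 3 ≡ᵇ 1)

  oneMod3-3q+ : ∀ q r → oneMod3 (3 * q + r) ≡ oneMod3 r
  oneMod3-3q+ q r = cong (λ x → 𝟙 (x ≡ᵇ 1))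
    (trans (cong (_% 3) (trans (+-comm (3 * q) r) (cong (r +_) (*-comm 3 q)))) ([m+kn]%n≡m%n r q 3))

  oneMod3-consecutive : ∀ k → oneMod3 k ℚ.+ oneMod3 (suc k) ℚ.+ oneMod3 (suc (suc k)) ≡ 1ℚ
  oneMod3-consecutive 0 = refl
  oneMod3-consecutive 1 = refl
  oneMod3-consecutive 2 = refl
  oneMod3-consecutive (suc (suc (suc k))) = trans
    (cong₂ ℚ._+_ (cong₂ ℚ._+_ (oneMod3-3q+ 1 k) (oneMod3-3q+ 1 (suc k))) (oneMod3-3q+ 1 (suc (suc k))))
    (oneMod3-consecutive k)

  %3≡1⇔ : ∀ {D} → D % 3 ≡ 1 ⇔ (∃[ q ] D ≡ 3 * q + 1)
  %3≡1⇔ {D} = mk⇔ to from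
    where
    to : D % 3 ≡ 1 → ∃[ q ] D ≡ 3 * q + 1
    to D%3≡1 = D / 3 , (begin
      D                   ≡⟨ m≡m%n+[m/n]*n D 3 ⟩
      D % 3 + D / 3 * 3   ≡⟨ cong (_+ D / 3 * 3) D%3≡1 ⟩
      1 + D / 3 * 3       ≡⟨ +-comm 1 (D / 3 * 3) ⟩
      D / 3 * 3 + 1       ≡⟨ cong (_+ 1) (*-comm (D / 3) 3) ⟩
      3 * (D / 3) + 1     ∎)
      where open ≡-Reasoning
    from : ∃[ q ] D ≡ 3 * q + 1 → D % 3 ≡ 1
    from (q , refl) = trans (cong (_% 3) (trans (+-comm (3 * q) 1) (cong (1 +_) (*-comm 3 q)))) ([m+kn]%n≡m%n 1 q 3)

  3q+1≤3m+2⇒q≤m : ∀ q m → 3 * q + 1 ≤ 3 * m + 2 → q ≤ m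
  3q+1≤3m+2⇒q≤m q m 3q+1≤3m+2 = s≤s⁻¹ (*-cancelˡ-< 3 q (suc m) (begin-strict
    3 * q       <⟨ m<m+n (3 * q) z<s ⟩
    3 * q + 1   ≤⟨ 3q+1≤3m+2 ⟩
    3 * m + 2   <⟨ +-monoʳ-< (3 * m) (n<1+n 2) ⟩
    3 * m + 3   ≡⟨ +-comm (3 * m) 3 ⟩
    3 + 3 * m   ≡⟨ *-suc 3 m ⟨
    3 * suc m   ∎))
    where open ≤-Reasoning

  [3q+1]+[3[m∸q]+1]≡3m+2 : ∀ q m → q ≤ m → (3 * q + 1) + (3 * (m ∸ q) + 1) ≡ 3 * m + 2
  [3q+1]+[3[m∸q]+1]≡3m+2 q m q≤m = trans (regroup q (m ∸ q)) (cong (λ z → 3 * z + 2) (m+[n∸m]≡n q≤m))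
    where
    regroup : ∀ q t → (3 * q + 1) + (3 * t + 1) ≡ 3 * (q + t) + 2
    regroup = solve-∀

  complement-3t+1 : ∀ m t {D D′} → D + D′ ≡ 3 * m + 2 → D′ ≡ 3 * t + 1 → D ≡ 3 * (m ∸ t) + 1
  complement-3t+1 m t {D} D+D′≡3m+2 refl = +-cancelʳ-≡ (3 * t + 1) D (3 * (m ∸ t) + 1) (begin
    D + (3 * t + 1)                   ≡⟨ D+D′≡3m+2 ⟩
    3 * m + 2                         ≡⟨ [3q+1]+[3[m∸q]+1]≡3m+2 t m t≤m ⟨
    (3 * t + 1) + (3 * (m ∸ t) + 1)   ≡⟨ +-comm (3 * t + 1) (3 * (m ∸ t) + 1) ⟩
    (3 * (m ∸ t) + 1) + (3 * t + 1)   ∎)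
    where
    open ≡-Reasoning
    t≤m : t ≤ m
    t≤m = 3q+1≤3m+2⇒q≤m t m (subst (3 * t + 1 ≤_) D+D′≡3m+2 (m≤n+m (3 * t + 1) D))

  oneMod3-complement : ∀ {m D D′} → D + D′ ≡ 3 * m + 2 → oneMod3 D ≡ oneMod3 D′
  oneMod3-complement {m} {D} {D′} D+D′≡3m+2 = cong 𝟙 (≡ᵇ-cong-⇔ {D % 3} {1} {D′ % 3} {1}
    (⇔.trans %3≡1⇔ (⇔.trans (mk⇔ to from) (⇔.sym %3≡1⇔))))
    where
    to : ∃[ q ] D ≡ 3 * q + 1 → ∃[ q ] D′ ≡ 3 * q + 1
    to (q , D≡3q+1) = m ∸ q , complement-3t+1 m q (trans (+-comm D′ D) D+D′≡3m+2) D≡3q+1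
    from : ∃[ q ] D′ ≡ 3 * q + 1 → ∃[ q ] D ≡ 3 * q + 1
    from (q , D′≡3q+1) = m ∸ q , complement-3t+1 m q D+D′≡3m+2 D′≡3q+1

  [1+k+[n∸1]]%n≡k : ∀ {n} .{{_ : NonZero n}} {k} → k < n → (suc k + (n ∸ 1)) % n ≡ k
  [1+k+[n∸1]]%n≡k {n} {k} k<n = begin
    (suc k + (n ∸ 1)) % n      ≡⟨ cong (_% n) (+-suc k (n ∸ 1)) ⟨
    (k + suc (n ∸ 1)) % n      ≡⟨ cong (λ z → (k + z) % n) (trans (+-comm 1 (n ∸ 1)) (m∸n+n≡m 1≤n)) ⟩
    (k + n) % n                ≡⟨ [m+n]%n≡m%n k n ⟩
    k % n                      ≡⟨ m<n⇒m%n≡m k<n ⟩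
    k                          ∎
    where
    open ≡-Reasoning
    1≤n : 1 ≤ n
    1≤n = ≤-trans (s≤s z≤n) k<n

  oneMod3-window : ∀ m {n} .{{_ : NonZero n}} → n ≡ 3 * m + 2 → ∀ {D} → D < n →
    oneMod3 D ℚ.+ oneMod3 ((D + 1) % n) ℚ.+ oneMod3 ((D + (n ∸ 1)) % n) ≡ 𝟙 (D ≡ᵇ 0) ℚ.+ 1ℚ
  oneMod3-window m {n} n≡3m+2 {zero} _ = cong₂ ℚ._+_ (cong (oneMod3 0 ℚ.+_) (cong oneMod3 (m<n⇒m%n≡m 1<n)))
    (trans (cong oneMod3 (trans (m<n⇒m%n≡m n∸1<n) n∸1≡3m+1)) (oneMod3-3q+ m 1))
    where
    1<n : 1 < n
    1<n = subst (1 <_) (sym n≡3m+2) (m≤n+m 2 (3 * m))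
    n∸1<n : n ∸ 1 < n
    n∸1<n = ∸-monoʳ-< {n} {1} {0} z<s (<⇒≤ 1<n)
    n∸1≡3m+1 : n ∸ 1 ≡ 3 * m + 1
    n∸1≡3m+1 = trans (cong (_∸ 1) n≡3m+2) (+-∸-assoc (3 * m) {2} {1} (s≤s z≤n))
  oneMod3-window m {n} n≡3m+2 {suc k} 2+k≤n with m≤n⇒m<n∨m≡n 2+k≤n
  ... | inj₁ 2+k<n = begin
    oneMod3 (suc k) ℚ.+ oneMod3 ((suc k + 1) % n) ℚ.+ oneMod3 ((suc k + (n ∸ 1)) % n)
      ≡⟨ cong₂ (λ x y → oneMod3 (suc k) ℚ.+ oneMod3 x ℚ.+ oneMod3 y)
           (trans (cong (_% n) (+-comm (suc k) 1)) (m<n⇒m%n≡m 2+k<n)) ([1+k+[n∸1]]%n≡k (<-trans (n<1+n k) 2+k≤n)) ⟩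
    oneMod3 (suc k) ℚ.+ oneMod3 (suc (suc k)) ℚ.+ oneMod3 k
      ≡⟨ solve 3 (λ a b c → a :+ b :+ c := c :+ a :+ b) refl (oneMod3 (suc k)) (oneMod3 (suc (suc k))) (oneMod3 k) ⟩
    oneMod3 k ℚ.+ oneMod3 (suc k) ℚ.+ oneMod3 (suc (suc k))
      ≡⟨ oneMod3-consecutive k ⟩
    1ℚ ∎
    where
    open ≡-Reasoning
    open +-*-Solver
  ... | inj₂ 2+k≡n = cong₂ ℚ._+_ (cong₂ ℚ._+_ oneMod3[1+k]≡1 oneMod3[n%n]≡0) oneMod3[k]≡0
    where
    k≡3m : k ≡ 3 * m
    k≡3m = +-cancelʳ-≡ 2 k (3 * m) (trans (+-comm k 2) (trans 2+k≡n n≡3m+2))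
    oneMod3[1+k]≡1 : oneMod3 (suc k) ≡ 1ℚ
    oneMod3[1+k]≡1 = trans (cong oneMod3 (trans (cong suc k≡3m) (+-comm 1 (3 * m)))) (oneMod3-3q+ m 1)
    oneMod3[n%n]≡0 : oneMod3 ((suc k + 1) % n) ≡ 0ℚ
    oneMod3[n%n]≡0 = cong oneMod3 (trans (cong (_% n) (trans (+-comm (suc k) 1) 2+k≡n)) (n%n≡0 n))
    k<n : k < n
    k<n = <-trans (n<1+n k) (subst (suc k <_) 2+k≡n ≤-refl)
    oneMod3[k]≡0 : oneMod3 ((suc k + (n ∸ 1)) % n) ≡ 0ℚ
    oneMod3[k]≡0 = trans (cong oneMod3 (trans ([1+k+[n∸1]]%n≡k k<n) (trans k≡3m (sym (+-identityʳ (3 * m))))))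
      (oneMod3-3q+ m 0)

  T-any-upTo⇔ : ∀ {P : ℕ → Set} (p : ℕ → Bool) → (∀ t → T (p t) ⇔ P t) →
                ∀ T′ → T (any p (upTo T′)) ⇔ (∃[ t ] t < T′ × P t)
  T-any-upTo⇔ p p⇔P T′ = mk⇔ to from
    where
    to : T (any p (upTo T′)) → ∃[ t ] t < T′ × _
    to h with t , t∈ , pt ← find (any⁻ p (upTo T′) h) = t , ∈-upTo⁻ t∈ , Equivalence.to (p⇔P t) pt
    from : (∃[ t ] t < T′ × _) → T (any p (upTo T′))
    from (t , t<T′ , Pt) = any⁺ p (lose (∈-upTo⁺ t<T′) (Equivalence.from (p⇔P t) Pt))

  oneMod3-below-split : ∀ m {n D} → n ≡ 3 * m + 2 → D < n →
    (∃[ t ] t < ⌈ suc m /2⌉ × (D ≡ 3 * t + 1 ⊎ D + (3 * t + 1) ≡ n)) ⇔ (∃[ q ] D ≡ 3 * q + 1)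
  oneMod3-below-split m {n} {D} n≡3m+2 D<n = mk⇔ to from
    where
    T′ : ℕ
    T′ = ⌈ suc m /2⌉
    to : ∃[ t ] t < T′ × (D ≡ 3 * t + 1 ⊎ D + (3 * t + 1) ≡ n) → ∃[ q ] D ≡ 3 * q + 1
    to (t , _ , inj₁ D≡3t+1)    = t , D≡3t+1
    to (t , _ , inj₂ D+3t+1≡n) = m ∸ t , complement-3t+1 m t (trans D+3t+1≡n n≡3m+2) refl
    from : ∃[ q ] D ≡ 3 * q + 1 → ∃[ t ] t < T′ × (D ≡ 3 * t + 1 ⊎ D + (3 * t + 1) ≡ n)
    -- Of q and m ∸ q, the smaller one is below ⌈(m+1)/2⌉.
    from (q , D≡3q+1) with q <? T′
    ... | yes q<T′ = q , q<T′ , inj₁ D≡3q+1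
    ... | no  q≮T′ = m ∸ q , m<n+o⇒m∸n<o m q m<q+T′ , inj₂ D+[3[m∸q]+1]≡n
      where
      q≤m : q ≤ m
      q≤m = 3q+1≤3m+2⇒q≤m q m (subst₂ _≤_ D≡3q+1 n≡3m+2 (<⇒≤ D<n))
      D+[3[m∸q]+1]≡n : D + (3 * (m ∸ q) + 1) ≡ n
      D+[3[m∸q]+1]≡n = begin
        D + (3 * (m ∸ q) + 1)               ≡⟨ cong (_+ (3 * (m ∸ q) + 1)) D≡3q+1 ⟩
        (3 * q + 1) + (3 * (m ∸ q) + 1)     ≡⟨ [3q+1]+[3[m∸q]+1]≡3m+2 q m q≤m ⟩
        3 * m + 2                           ≡⟨ n≡3m+2 ⟨
        n                                   ∎
        where open ≡-Reasoning
      m<q+T′ : m < q + T′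
      m<q+T′ = begin
        suc m                         ≡⟨ ⌊n/2⌋+⌈n/2⌉≡n (suc m) ⟨
        ⌊ suc m /2⌋ + T′              ≤⟨ +-monoˡ-≤ T′ (⌊n/2⌋≤⌈n/2⌉ (suc m)) ⟩
        T′ + T′                       ≤⟨ +-monoˡ-≤ T′ (≮⇒≥ q≮T′) ⟩
        q + T′                        ∎
        where open ≤-Reasoning

  N[1+m]≡3m+2 : ∀ m → N (suc m) ≡ 3 * m + 2
  N[1+m]≡3m+2 m = trans (cong (_∸ 1) (*-suc 3 m)) (+-comm 2 (3 * m))

  3≤N[2+m] : ∀ m → 3 ≤ N (suc (suc m))
  3≤N[2+m] m = subst (3 ≤_) (sym (N[1+m]≡3m+2 (suc m))) (≤-trans (*-monoʳ-≤ 3 (s≤s z≤n)) (m≤m+n (3 * suc m) 2))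

  A-circulant : ∀ m → Circulant oneMod3 (A (suc m))
  A-circulant m i j = cong 𝟙 (T-⇔⇒≡ (begin
    T (any adjacent (upTo ⌈ suc m /2⌉))
      ∼⟨ T-any-upTo⇔ adjacent adjacent⇔ ⌈ suc m /2⌉ ⟩
    (∃[ t ] t < ⌈ suc m /2⌉ × (D ≡ 3 * t + 1 ⊎ D + (3 * t + 1) ≡ n))
      ∼⟨ oneMod3-below-split m (N[1+m]≡3m+2 m) (diffmod<n i j) ⟩
    (∃[ q ] D ≡ 3 * q + 1)
      ∼⟨ ⇔.sym %3≡1⇔ ⟩
    D % 3 ≡ 1
      ∼⟨ ⇔.sym T-≡ᵇ⇔≡ ⟩
    T (D % 3 ≡ᵇ 1) ∎))
    where
    open EquationalReasoning {k = Kind.equivalence}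
    n D : ℕ
    n = N (suc m)
    D = diffmod n i j
    adjacent : ℕ → Bool
    adjacent t = (D ≡ᵇ 3 * t + 1) ∨ (D + (3 * t + 1) ≡ᵇ n)
    adjacent⇔ : ∀ t → T (adjacent t) ⇔ (D ≡ 3 * t + 1 ⊎ D + (3 * t + 1) ≡ n)
    adjacent⇔ t = ⇔.trans T-∨ (T-≡ᵇ⇔≡ ⊎-⇔ T-≡ᵇ⇔≡)

  A-sym : ∀ m → Symmetric (A (suc m))
  A-sym m = circulant-sym {f = oneMod3} (A-circulant m)
    λ {D} {D′} _ _ D+D′≡n → oneMod3-complement {m} {D} {D′} (trans D+D′≡n (N[1+m]≡3m+2 m))

  A·W≡Id⊕J : ∀ m .{{_ : NonZero (N (suc m))}} → 3 ≤ N (suc m) →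
             (A (suc m) · W (N (suc m))) ≡ᴹ (Id (N (suc m)) ⊕ J (N (suc m)))
  A·W≡Id⊕J m 3≤n i j = begin
    (A (suc m) · W n) i j                                              ≡⟨ circulant·W 3≤n {f = oneMod3} (A-circulant m) i j ⟩
    oneMod3 D ℚ.+ oneMod3 ((D + 1) % n) ℚ.+ oneMod3 ((D + (n ∸ 1)) % n) ≡⟨ oneMod3-window m (N[1+m]≡3m+2 m) (diffmod<n i j) ⟩
    𝟙 (D ≡ᵇ 0) ℚ.+ 1ℚ                                                  ≡⟨ cong (ℚ._+ 1ℚ) (Id≡𝟙[diffmod≡ᵇ0] i j) ⟨
    Id n i j ℚ.+ 1ℚ                                                    ∎
    where
    open ≡-Reasoning
    n D : ℕ
    n = N (suc m)
    D = diffmod n i j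

open Circulants

lemma5p7 : (d : ℕ) → d ≥ 2 →
    Σ (Mat (N d)) (λ B →
      ((A d · B) ≡ᴹ Id (N d)) × ((B · A d) ≡ᴹ Id (N d)) ×
      (((B ᵀ) · (((½ • A d) ⊖ (ℕ→ℚ (d C 2) • J (N d))) · B))
        ≡ᴹ (½ • (W (N d) ⊖ J (N d)))))
lemma5p7 (suc zero) (s≤s ())
lemma5p7 (suc (suc e)) _ = B , A·B≡Id , B·A≡Id , Bᵀ[½A⊖cJ]B≡½[W⊖J]
  where
  m : ℕ
  m = suc e
  3≤n : 3 ≤ N (suc m)
  3≤n = 3≤N[2+m] e
  open InverseFromW {k = m} (N[1+m]≡3m+2 m) (A-sym m) (W-sym (N (suc m))) (A·W≡Id⊕J m 3≤n) (J·W 3≤n)
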